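{- The one-variable fragment $\mathbf{QK}\cap\mathcal{QML}^{1}$ with unbounded counting quantifiers (subscripts written in binary) has the exponential finite model property: there is a polynomial $p$ such that every formula $\varphi\in\mathcal{QML}^{1}$ that is satisfiable with respect to $\mathbf{QK}$ is satisfied in some constant-domain first-order Kripke model $(F,D,\mathfrak d,I)$ with $F=(W,R)$ in which both $|W|\le 2^{p(|\varphi|)}$ and $|D|\le 2^{p(|\varphi|)}$.
   Context: Fix a countably infinite set of predicate symbols, each with an arity, and a set of first-order variables. Formulas of $\mathcal{QML}$ are generated by $\varphi ::= P(x_{1},\dots,x_{n})\mid\neg\varphi\mid(\varphi_1\wedge\varphi_2)\mid\Diamond\varphi\mid\exists[\le c]x\,\varphi$, where $c\in\mathbb N$ is written as a binary string, and $|\varphi|$ is the length of $\varphi$ as a string. Abbreviations: $\Box\varphi:=\neg\Diamond\neg\varphi$, $\exists x\varphi:=\neg\exists[\le 0]x\varphi$, $\forall x\varphi:=\exists[\le0]x\neg\varphi$. $\mathcal{QML}^1$ is the set of formulas containing only the single variable $x$. A constant-domain first-order Kripke model is $M=(F,D,\mathfrak d,I)$ with $F=(W,R)$ a Kripke frame (any binary relation $R$ on a set $W$), $D$ a nonempty set, $\mathfrak d(w)=D$ for all $w$, and $I(w,P)\subseteq D^n$ for each $n$-ary $P$. Truth $M,w\models^{a}\varphi$ under an assignment $a$ of variables to $D$: atoms by membership of the tuple of values in $I(w,P)$; Booleans as usual; $M,w\models^a\Diamond\varphi$ iff $M,v\models^a\varphi$ for some $v$ with $wRv$; $M,w\models^a\exists[\le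 c]x\varphi$ iff the number of $b\in D$ with $M,w\models^{a(x/b)}\varphi$ is at most $c$. A formula is satisfiable with respect to $\mathbf{QK}$ if it is true at some world under some assignment in some constant-domain model (over an arbitrary frame). -}

module Defs where

open import Data.Nat using (ℕ; zero; suc; _+_; _*_; _^_; _≤_)
open import Data.Nat.Logarithm using (⌊log₂_⌋)
open import Data.Fin using (Fin)
open import Data.Vec using (Vec; replicate)
open import Data.List using (List; []; _∷_)
open import Data.Product using (Σ; _×_; ∃)
open import Data.Empty using (⊥)
open import Function.Definitions using (Injective)
open import Relation.Binary.PropositionalEquality using (_≡_)
open import Relation.Nullary using (¬_)

-- Predicate symbols are natural numbers; a signature assigns each an arity
-- (ar : ℕ → ℕ).  Since QML¹ has the single variable x, an atom is P(x,…,x).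
data Fml : Set where
  atom : ℕ → Fml
  neg  : Fml → Fml
  conj : Fml → Fml → Fml
  dia  : Fml → Fml
  cnt  : ℕ → Fml → Fml   -- ∃[≤ c] x φ

bitlen : ℕ → ℕ
bitlen c = suc ⌊log₂ c ⌋

-- |φ| : length of φ as a string.  Atom P(x,…,x) of arity n: symbol P,
-- two parentheses, n occurrences of x, and commas (counted as 2n + 2).
len : (ar : ℕ → ℕ) → Fml → ℕ
len ar (atom P)   = 2 * ar P + 2
len ar (neg φ)    = 1 + len ar φ
len ar (conj φ ψ) = 3 + len ar φ + len ar ψ
len ar (dia φ)    = 1 + len ar φ
len ar (cnt c φ)  = 6 + bitlen c + len ar φ   -- "∃[≤" c "]x" φ

record Model (ar : ℕ → ℕ) : Set₁ where
  field
    W   : Set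
    R   : W → W → Set
    D   : Set
    pt  : D
    I   : W → (P : ℕ) → Vec D (ar P) → Set

Sat : {ar : ℕ → ℕ} (M : Model ar) → Model.W M → Model.D M → Fml → Set
Sat {ar} M w b (atom P)   = Model.I M w P (replicate (ar P) b)
Sat M w b (neg φ)    = ¬ Sat M w b φ
Sat M w b (conj φ ψ) = Sat M w b φ × Sat M w b ψ
Sat M w b (dia φ)    = Σ (Model.W M) λ v → Model.R M w v × Sat M v b φ
Sat M w b (cnt c φ)  =
  ¬ (Σ (Fin (suc c) → Model.D M) λ f →
        Injective _≡_ _≡_ f × ((i : Fin (suc c)) → Sat M w (f i) φ))

Satisfiable : (ar : ℕ → ℕ) → Fml → Set₁
Satisfiable ar φ = Σ (Model ar) λ M → Σ (Model.W M) λ w → Σ (Model.D M) λ b → Sat M w b φ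

-- polynomials with natural coefficients, coefficient list [a₀, a₁, …]
evalPoly : List ℕ → ℕ → ℕ
evalPoly []       n = 0
evalPoly (a ∷ as) n = a + n * evalPoly as n

-- Classically one would fix, at each world, up to c elements of every type (set of subformulas
-- of φ); an arbitrary model admits no such choice constructively. The construction is therefore
-- carried out under double negation, where each of the finitely many case distinctions it needs
-- is available. It yields a model described by finite tables, and as the existence of such tables
-- of bounded size is decidable by exhaustive search, the double negation can be removed.
--
-- A family of representatives g : Fin K → D is faithful at w with threshold c if every type is
-- either represented exactly (each element once) or by at least c distinct elements; then any
-- ∃[≤ c′] x ψ with c′ < c is evaluated at w correctly on the representatives. Starting from the
-- threshold 2^|φ|·T^d (T the number of types, d the modal depth of φ), M is unravelled to depth d:
-- each pair of a representative and a diamond subformula of its type gets a witness world, at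
-- which the representatives are reassigned, keeping their types at the parent, so as to be
-- faithful with the threshold divided by T. Then K ≤ T^(d+1)·2^|φ|, and the tree has at most
-- (1 + K·|φ|)^d nodes.

module Submission where

open import Defs
open import Data.Bool using (Bool; true; false)
import Data.Bool as Bool
open import Data.Empty using (⊥; ⊥-elim)
open import Data.Fin using (Fin; zero; suc; inject≤; combine; remQuot; fromℕ<)
open import Data.Fin.Permutation using (Permutation′; _⟨$⟩ʳ_; _⟨$⟩ˡ_; inverseˡ; inverseʳ; transpose)
open import Data.Fin.Properties
  using (_≟_; any?; all?; *↔×; +↔⊎; 2↔Bool; 1↔⊤; injective⇒≤; inject≤-injective; combine-injective;
         remQuot-combine; combine-remQuot)
open import Data.List using (List; []; _∷_; _++_; length)
import Data.List as List
open import Data.List.Membership.Propositional using (_∈_)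
open import Data.List.Membership.Propositional.Properties using (∈-++⁺ˡ; ∈-++⁺ʳ; ∈-++⁻; ∈-lookup)
open import Data.List.Properties using (length-++)
open import Data.List.Relation.Binary.Subset.Propositional using (_⊆_)
open import Data.List.Relation.Unary.Any using (here; there)
import Data.List.Relation.Unary.Any as Any
open import Data.List.Relation.Unary.Any.Properties using (lookup-index)
open import Data.Nat using (ℕ; zero; suc; _+_; _*_; _^_; _⊔_; _≤_; _<_; z≤n; s≤s; _≤?_; _<?_; NonZero)
import Data.Nat as ℕ
open import Data.Nat.Logarithm using (⌊log₂_⌋; ⌊log₂⌋-mono-≤; ⌊log₂[2^n]⌋≡n)
open import Data.Nat.Properties
  using (≤-refl; ≤-reflexive; ≤-trans; ≤-pred; ≮⇒≥; ≰⇒>; <⇒≱; 1+n≰n; n<1+n; m≤m+n; m≤n+m; n≤1+n;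
         m≤n⇒m≤1+n; m≤n*m; +-mono-≤; +-monoˡ-≤; *-mono-≤; *-monoʳ-≤; *-monoʳ-<; ^-monoʳ-≤; ^-monoˡ-≤;
         +-identityʳ; *-identityʳ; *-comm; *-suc; ^-*-assoc; m^n≢0; m^n>0; ⊔-lub; m≤m⊔n; m≤n⊔m;
         anyUpTo?; module ≤-Reasoning)
open import Data.Nat.Tactic.RingSolver using (solve-∀)
open import Data.Product using (Σ; ∃; _×_; _,_; proj₁; proj₂; uncurry)
open import Data.Product.Function.NonDependent.Propositional using (_×-↔_)
import Data.Product.Properties as Product
open import Data.Sum using (_⊎_; inj₁; inj₂)
open import Data.Sum.Function.Propositional using (_⊎-↔_)
open import Data.Unit using (⊤; tt)
open import Data.Vec using (Vec; []; _∷_; lookup; tabulate; replicate)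
open import Data.Vec.Properties using (lookup∘tabulate; tabulate∘lookup; tabulate-cong)
open import Effect.Monad using (RawMonad)
open import Function using (_∘_; id; case_of_)
open import Function.Bundles using (_↔_; _⇔_; mk↔ₛ′; mk⇔; Inverse; Equivalence)
open import Function.Construct.Identity using (↔-id)
open import Function.Definitions using (Injective)
open import Function.Properties.Equivalence using (⇔-isEquivalence)
open import Function.Properties.Inverse using (↔-sym; ↔-trans)
open import Level using (0ℓ)
open import Relation.Binary.PropositionalEquality
open import Relation.Binary.Structures using (IsEquivalence)
open import Relation.Nullary using (¬_; Dec; yes; no; does)
open import Relation.Nullary.Decidable
  using (decidable-stable; map′; _×-dec_; _⊎-dec_; _→-dec_; ¬?; ¬¬-excluded-middle; dec-true)
open import Relation.Nullary.Negation using (¬¬-Monad)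
open import Relation.Unary using (Decidable)

open RawMonad (¬¬-Monad {0ℓ}) using (pure; _>>=_)

-- Finite combinatorics under double negation

¬¬-pull-Fin : ∀ {n} {P : Fin n → Set} → (∀ i → ¬ ¬ P i) → ¬ ¬ (∀ i → P i)
¬¬-pull-Fin {zero} h = pure λ ()
¬¬-pull-Fin {suc n} h = do
  p₀ ← h zero
  ps ← ¬¬-pull-Fin (h ∘ suc)
  pure λ { zero → p₀ ; (suc i) → ps i }

¬¬-pull-Fin² : ∀ {m n} {P : Fin m × Fin n → Set} → (∀ y → ¬ ¬ P y) → ¬ ¬ (∀ y → P y)
¬¬-pull-Fin² h = ¬¬-pull-Fin (λ i → ¬¬-pull-Fin λ j → h (i , j)) >>= λ h′ → pure λ (i , j) → h′ i j

all⊎any : ∀ {n} {A B : Fin n → Set} → (∀ i → A i ⊎ B i) → (∀ i → A i) ⊎ ∃ B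
all⊎any {zero} h = inj₁ λ ()
all⊎any {suc n} h with h zero | all⊎any (h ∘ suc)
... | inj₂ b | _ = inj₂ (zero , b)
... | inj₁ a | inj₁ as = inj₁ λ { zero → a ; (suc i) → as i }
... | inj₁ _ | inj₂ (i , b) = inj₂ (suc i , b)

Searchable : Set → Set₁
Searchable A = ∀ {Q : A → Set} → Decidable Q → Dec (∃ Q)

search-× : ∀ {A B} → Searchable A → Searchable B → Searchable (A × B)
search-× sA sB Q? = map′ (λ (a , b , q) → (a , b) , q) (λ ((a , b) , q) → a , b , q)
  (sA λ a → sB λ b → Q? (a , b))

search-Vec : ∀ {A} → Searchable A → ∀ n → Searchable (Vec A n)
search-Vec sA zero Q? = map′ ([] ,_) (λ { ([] , q) → q }) (Q? [])
search-Vec sA (suc n) Q? = map′ (λ (a , v , q) → a ∷ v , q) (λ { (a ∷ v , q) → a , v , q })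
  (sA λ a → search-Vec sA n λ v → Q? (a ∷ v))

search-Bool : Searchable Bool
search-Bool Q? = map′ (λ { (inj₁ q) → true , q ; (inj₂ q) → false , q })
                      (λ { (true , q) → inj₁ q ; (false , q) → inj₂ q }) (Q? true ⊎-dec Q? false)

AtLeast : (n : ℕ) {A : Set} → (A → Set) → Set
AtLeast n {A} P = Σ (Fin n → A) λ f → Injective _≡_ _≡_ f × (∀ i → P (f i))

AtLeast-map : ∀ {n} {A : Set} {P Q : A → Set} → (∀ {x} → P x → Q x) → AtLeast n P → AtLeast n Q
AtLeast-map P⇒Q (f , f-injective , sat) = f , f-injective , P⇒Q ∘ sat

atLeast? : ∀ n {k} {P : Fin k → Set} → Decidable P → Dec (AtLeast n P)
atLeast? n {k} {P} P? =
  map′ fromVec toVec (search-Vec any? n λ v → injective? (lookup v) ×-dec all? (P? ∘ lookup v))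
  where
  Distinct : (Fin n → Fin k) → Set
  Distinct f = ∀ i j → f i ≡ f j → i ≡ j
  injective? : (f : Fin n → Fin k) → Dec (Distinct f)
  injective? f = all? λ i → all? λ j → (f i ≟ f j) →-dec (i ≟ j)
  fromVec : (∃ λ v → Distinct (lookup v) × ∀ i → P (lookup v i)) → AtLeast n P
  fromVec (v , distinct , p) = lookup v , distinct _ _ , p
  toVec : AtLeast n P → ∃ λ v → Distinct (lookup v) × ∀ i → P (lookup v i)
  toVec (f , f-injective , p) =
    tabulate f , (λ i j eq → f-injective (trans (sym (lookup-tab i)) (trans eq (lookup-tab j)))) ,
    λ i → subst P (sym (lookup-tab i)) (p i)
    where lookup-tab = lookup∘tabulate f

lookup∘tabulate² : ∀ {A : Set} {m n} (f : Fin m → Fin n → A) u v →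
                   lookup (lookup (tabulate (tabulate ∘ f)) u) v ≡ f u v
lookup∘tabulate² f u v = trans (cong (λ row → lookup row v) (lookup∘tabulate _ u)) (lookup∘tabulate (f u) v)

∷↔× : ∀ {A : Set} {n} → Vec A (suc n) ↔ (A × Vec A n)
∷↔× = mk↔ₛ′ (λ { (a ∷ v) → a , v }) (λ (a , v) → a ∷ v) (λ _ → refl) (λ { (a ∷ v) → refl })

Vec↔Fin^ : ∀ {A : Set} {N} → A ↔ Fin N → ∀ d → Vec A d ↔ Fin (N ^ d)
Vec↔Fin^ A↔ zero = mk↔ₛ′ (λ _ → zero) (λ _ → []) (λ { zero → refl }) (λ { [] → refl })
Vec↔Fin^ A↔ (suc d) = ↔-trans ∷↔× (↔-trans (A↔ ×-↔ Vec↔Fin^ A↔ d) (↔-sym *↔×))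

from-injective : ∀ {A B : Set} (ι : A ↔ B) → Injective _≡_ _≡_ (Inverse.from ι)
from-injective ι {x} {y} eq =
  trans (sym (Inverse.strictlyInverseˡ ι x)) (trans (cong (Inverse.to ι) eq) (Inverse.strictlyInverseˡ ι y))

∑ : ∀ n → (Fin n → ℕ) → ℕ
∑ zero a = 0
∑ (suc n) a = a zero + ∑ n (a ∘ suc)

∑-≤ : ∀ n {a : Fin n → ℕ} {B} → (∀ i → a i ≤ B) → ∑ n a ≤ n * B
∑-≤ zero h = z≤n
∑-≤ (suc n) h = +-mono-≤ (h zero) (∑-≤ n (h ∘ suc))

Σ-Fin-suc↔ : ∀ {n} {P : Fin (suc n) → Set} → Σ (Fin (suc n)) P ↔ (P zero ⊎ Σ (Fin n) (P ∘ suc))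
Σ-Fin-suc↔ = mk↔ₛ′ (λ { (zero , p) → inj₁ p ; (suc i , p) → inj₂ (i , p) })
                   (λ { (inj₁ p) → zero , p ; (inj₂ (i , p)) → suc i , p })
                   (λ { (inj₁ p) → refl ; (inj₂ (i , p)) → refl })
                   (λ { (zero , p) → refl ; (suc i , p) → refl })

Σ-Fin↔∑ : ∀ n (a : Fin n → ℕ) → Σ (Fin n) (Fin ∘ a) ↔ Fin (∑ n a)
Σ-Fin↔∑ zero a = mk↔ₛ′ (λ ()) (λ ()) (λ ()) (λ ())
Σ-Fin↔∑ (suc n) a = ↔-trans Σ-Fin-suc↔ (↔-trans (↔-id _ ⊎-↔ Σ-Fin↔∑ n (a ∘ suc)) (↔-sym +↔⊎))

does⇔ : ∀ {A : Set} (a? : Dec A) → does a? ≡ true ⇔ A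
does⇔ (yes a) = mk⇔ (λ _ → a) (λ _ → refl)
does⇔ (no ¬a) = mk⇔ (λ ()) (λ a → ⊥-elim (¬a a))

≡true-unique : ∀ {x y : Bool} {A : Set} → x ≡ true ⇔ A → y ≡ true ⇔ A → x ≡ y
≡true-unique {false} {false} _ _ = refl
≡true-unique {false} {true} x⇔ y⇔ = Equivalence.from x⇔ (Equivalence.to y⇔ refl)
≡true-unique {true} {false} x⇔ y⇔ = sym (Equivalence.from y⇔ (Equivalence.to x⇔ refl))
≡true-unique {true} {true} _ _ = refl

transpose-matchˡ : ∀ {n} (i j : Fin n) → transpose i j ⟨$⟩ʳ i ≡ j
transpose-matchˡ i j rewrite dec-true (i ≟ i) refl = refl

transpose-preserves : ∀ {n} {A : Set} (f : Fin n → A) {i j} → f i ≡ f j →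
                      ∀ k → f (transpose i j ⟨$⟩ʳ k) ≡ f k
transpose-preserves f {i} {j} fi≡fj k with k ≟ i
... | yes refl = sym fi≡fj
... | no _ with k ≟ j
...   | yes refl = fi≡fj
...   | no _ = refl

module _ {A : Set} {n m} (f : Fin n → Fin m) (h : Fin n → A) (a : A) where

  extend : Fin m → A
  extend y with any? (λ x → f x ≟ y)
  ... | yes (x , _) = h x
  ... | no _ = a

  extend-hit : Injective _≡_ _≡_ f → ∀ x → extend (f x) ≡ h x
  extend-hit f-injective x with any? (λ x′ → f x′ ≟ f x)
  ... | yes (x′ , eq) = cong h (f-injective eq)
  ... | no none = ⊥-elim (none (x , refl))

  extend-view : ∀ y → extend y ≡ a ⊎ ∃ λ x → f x ≡ y × extend y ≡ h x
  extend-view y with any? (λ x → f x ≟ y)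
  ... | yes (x , eq) = inj₂ (x , eq , refl)
  ... | no _ = inj₁ refl

-- Samples

record Sample {A : Set} (Q : A → Set) (c : ℕ) : Set where
  field
    size           : ℕ
    size≤          : size ≤ c
    elem           : Fin size → A
    elem-injective : Injective _≡_ _≡_ elem
    elem-sat       : ∀ k → Q (elem k)
    complete       : size < c → ∀ {b} → Q b → ¬ ¬ (∃ λ k → elem k ≡ b)

sample : ∀ {A : Set} (Q : A → Set) c → ¬ ¬ Sample Q c
sample Q zero = pure record
  { size = 0 ; size≤ = z≤n ; elem = λ () ; elem-injective = λ {} ; elem-sat = λ () ; complete = λ () }
sample {A} Q (suc c) = sample Q c >>= step
  where
  raise : (s : Sample Q c) → (∀ {b} → Q b → ¬ ¬ (∃ λ k → Sample.elem s k ≡ b)) → Sample Q (suc c)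
  raise s cover = record
    { Sample s ; size≤ = m≤n⇒m≤1+n (Sample.size≤ s) ; complete = λ _ → cover }

  step : Sample Q c → ¬ ¬ Sample Q (suc c)
  step s with Sample.size s <? c
  ... | yes size<c = pure (raise s (Sample.complete s size<c))
  ... | no size≮c = ¬¬-excluded-middle {A = ∃ λ b → Q b × ∀ k → Sample.elem s k ≢ b} >>= λ
    { (yes (b , q , fresh)) → pure (cons b q fresh)
    ; (no none) → pure (raise s λ {b} q notIn → none (b , q , λ k eq → notIn (k , eq))) }
    where
    open Sample s
    cons : ∀ b → Q b → (∀ k → elem k ≢ b) → Sample Q (suc c)
    cons b q fresh = record
      { size = suc size
      ; size≤ = s≤s size≤
      ; elem = elem′
      ; elem-injective = injective′
      ; elem-sat = λ { zero → q ; (suc k) → elem-sat k }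
      ; complete = λ size<1+c → ⊥-elim (size≮c (≤-pred size<1+c)) }
      where
      elem′ : Fin (suc size) → A
      elem′ zero = b
      elem′ (suc k) = elem k
      injective′ : Injective _≡_ _≡_ elem′
      injective′ {zero} {zero} _ = refl
      injective′ {zero} {suc j} eq = ⊥-elim (fresh j (sym eq))
      injective′ {suc i} {zero} eq = ⊥-elim (fresh i eq)
      injective′ {suc i} {suc j} eq = cong suc (elem-injective eq)

Sample-nonempty : ∀ {A : Set} {Q : A → Set} {c b} (s : Sample Q c) → 0 < c → Q b → ¬ ¬ Fin (Sample.size s)
Sample-nonempty {c = c} s 0<c q with Sample.size s <? c
... | yes small = Sample.complete s small q >>= pure ∘ proj₁
... | no ¬small = pure (fromℕ< (≤-trans 0<c (≮⇒≥ ¬small)))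

module _ {A : Set} {T m : ℕ} {Q : Fin T → A → Set} (s : ∀ j → Sample (Q j) (suc m)) where
  open Sample

  some-sample-full : .{{NonZero T}} → (xs : Fin (T * suc m) → A) → Injective _≡_ _≡_ xs →
                     (∀ l → ¬ ¬ (∃ λ j → Q j (xs l))) → ¬ ¬ (∃ λ j → suc m ≤ size (s j))
  some-sample-full xs xs-injective covered with any? (λ j → suc m ≤? size (s j))
  ... | yes full = pure full
  ... | no none = ¬¬-pull-Fin locate >>= λ where′ →
    ⊥-elim (<⇒≱ (*-monoʳ-< T (n<1+n m)) (injective⇒≤ (code-injective where′)))
    where
    size≤m : ∀ j → size (s j) ≤ m
    size≤m j = ≤-pred (≰⇒> λ full → none (j , full))
    Located : Fin (T * suc m) → Set
    Located l = Σ (Fin T) λ j → Σ (Fin (size (s j))) λ k → elem (s j) k ≡ xs l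
    locate : ∀ l → ¬ ¬ Located l
    locate l = covered l >>= λ (j , q) → complete (s j) (s≤s (size≤m j)) q >>= λ (k , eq) → pure (j , k , eq)
    code : ∀ {l} → Located l → Fin (T * m)
    code (j , k , _) = combine j (inject≤ k (size≤m j))
    code-injective : (where′ : ∀ l → Located l) → Injective _≡_ _≡_ (code ∘ where′)
    code-injective where′ {l} {l′} eq with where′ l | where′ l′ | eq
    ... | j , k , e | j′ , k′ , e′ | eq′ with combine-injective j _ j′ _ eq′
    ... | refl , k≡k′ =
      xs-injective (trans (sym e) (trans (cong (elem (s j)) (inject≤-injective _ _ _ _ k≡k′)) e′))

-- Subformulas and sizes

subs strictSubs : Fml → List Fml
subs φ = φ ∷ strictSubs φ

strictSubs (atom P)   = []
strictSubs (neg φ)    = subs φ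
strictSubs (conj φ ψ) = subs φ ++ subs ψ
strictSubs (dia φ)    = subs φ
strictSubs (cnt c φ)  = subs φ

subs-⊆ : ∀ {χ φ} → χ ∈ subs φ → subs χ ⊆ subs φ
subs-⊆ (here refl) = id
subs-⊆ {φ = atom P} (there ())
subs-⊆ {φ = neg φ} (there p) = there ∘ subs-⊆ p
subs-⊆ {φ = conj φ ψ} (there p) with ∈-++⁻ (subs φ) p
... | inj₁ q = there ∘ ∈-++⁺ˡ ∘ subs-⊆ q
... | inj₂ q = there ∘ ∈-++⁺ʳ (subs φ) ∘ subs-⊆ q
subs-⊆ {φ = dia φ} (there p) = there ∘ subs-⊆ p
subs-⊆ {φ = cnt c φ} (there p) = there ∘ subs-⊆ p

md : Fml → ℕ
md (atom P)   = 0
md (neg φ)    = md φ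
md (conj φ ψ) = md φ ⊔ md ψ
md (dia φ)    = suc (md φ)
md (cnt c φ)  = md φ

module _ {ψ φ : Fml} where
  neg-∈-subs : neg ψ ∈ subs φ → ψ ∈ subs φ
  neg-∈-subs p = subs-⊆ p (there (here refl))

  dia-∈-subs : dia ψ ∈ subs φ → ψ ∈ subs φ
  dia-∈-subs p = subs-⊆ p (there (here refl))

  cnt-∈-subs : ∀ {c} → cnt c ψ ∈ subs φ → ψ ∈ subs φ
  cnt-∈-subs p = subs-⊆ p (there (here refl))

  conj-∈-subsˡ : ∀ {χ} → conj ψ χ ∈ subs φ → ψ ∈ subs φ
  conj-∈-subsˡ {χ} p = subs-⊆ p (there (∈-++⁺ˡ {ys = subs χ} (here refl)))

  conj-∈-subsʳ : ∀ {χ} → conj χ ψ ∈ subs φ → ψ ∈ subs φ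
  conj-∈-subsʳ {χ} p = subs-⊆ p (there (∈-++⁺ʳ (subs χ) (here refl)))

module _ (ar : ℕ → ℕ) where

  len-∈-subs : ∀ {ψ φ} → ψ ∈ subs φ → len ar ψ ≤ len ar φ
  len-∈-subs (here refl) = ≤-refl
  len-∈-subs {φ = atom P} (there ())
  len-∈-subs {φ = neg φ} (there p) = m≤n⇒m≤1+n (len-∈-subs p)
  len-∈-subs {φ = conj φ ψ} (there p) with ∈-++⁻ (subs φ) p
  ... | inj₁ q = ≤-trans (len-∈-subs q) (≤-trans (m≤n+m (len ar φ) 3) (m≤m+n _ (len ar ψ)))
  ... | inj₂ q = ≤-trans (len-∈-subs q) (m≤n+m (len ar ψ) _)
  len-∈-subs {φ = dia φ} (there p) = m≤n⇒m≤1+n (len-∈-subs p)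
  len-∈-subs {φ = cnt c φ} (there p) = ≤-trans (len-∈-subs p) (m≤n+m (len ar φ) _)

  length-subs≤len : ∀ φ → length (subs φ) ≤ len ar φ
  length-subs≤len (atom P) = ≤-trans (n≤1+n 1) (m≤n+m 2 (2 * ar P))
  length-subs≤len (neg φ) = s≤s (length-subs≤len φ)
  length-subs≤len (conj φ ψ) rewrite length-++ (subs φ) {subs ψ} =
    s≤s (≤-trans (+-mono-≤ (length-subs≤len φ) (length-subs≤len ψ)) (+-mono-≤ (m≤n+m (len ar φ) 2) ≤-refl))
  length-subs≤len (dia φ) = s≤s (length-subs≤len φ)
  length-subs≤len (cnt c φ) = s≤s (≤-trans (length-subs≤len φ) (m≤n+m (len ar φ) (5 + bitlen c)))

  md≤len : ∀ φ → md φ ≤ len ar φ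
  md≤len (atom P) = z≤n
  md≤len (neg φ) = m≤n⇒m≤1+n (md≤len φ)
  md≤len (conj φ ψ) = ⊔-lub (≤-trans (md≤len φ) (≤-trans (m≤n+m (len ar φ) 3) (m≤m+n _ (len ar ψ))))
                             (≤-trans (md≤len ψ) (m≤n+m (len ar ψ) _))
  md≤len (dia φ) = s≤s (md≤len φ)
  md≤len (cnt c φ) = ≤-trans (md≤len φ) (m≤n+m (len ar φ) (6 + bitlen c))

  <2^bitlen : ∀ c → c < 2 ^ bitlen c
  <2^bitlen c = ≰⇒> λ 2^b≤c → 1+n≰n (begin
    bitlen c                  ≡⟨ sym (⌊log₂[2^n]⌋≡n (bitlen c)) ⟩
    ⌊log₂ 2 ^ bitlen c ⌋  ≤⟨ ⌊log₂⌋-mono-≤ 2^b≤c ⟩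
    ⌊log₂ c ⌋             ∎)
    where open ≤-Reasoning

  cnt-∈-subs-bound : ∀ {c ψ φ} → cnt c ψ ∈ subs φ → suc c ≤ 2 ^ len ar φ
  cnt-∈-subs-bound {c} {ψ} p = ≤-trans (<2^bitlen c)
    (^-monoʳ-≤ 2 (≤-trans (m≤n+m _ 6) (≤-trans (m≤m+n _ (len ar ψ)) (len-∈-subs p))))

n<2^n : ∀ n → n < 2 ^ n
n<2^n zero = s≤s z≤n
n<2^n (suc n) = begin-strict
  suc n          <⟨ s≤s (n<2^n n) ⟩
  suc (2 ^ n)    ≤⟨ +-monoˡ-≤ (2 ^ n) (m^n>0 2 n) ⟩
  2 ^ n + 2 ^ n  ≡⟨ cong (2 ^ n +_) (sym (+-identityʳ (2 ^ n))) ⟩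
  2 ^ suc n      ∎
  where open ≤-Reasoning

sizePoly : List ℕ
sizePoly = 0 ∷ 2 ∷ 4 ∷ 1 ∷ []

sizePoly≡ : ∀ n → evalPoly sizePoly n ≡ n * ((3 + n) * n) + n * (2 + n)
sizePoly≡ = unfolded
  where
  unfolded : ∀ n → 0 + n * (2 + n * (4 + n * (1 + n * 0))) ≡ n * ((3 + n) * n) + n * (2 + n)
  unfolded = solve-∀

size-bounds : ∀ {n S d K} → S ≤ n → d ≤ n → 1 ≤ K → K ≤ (2 ^ n) ^ (2 + d) →
              K ≤ 2 ^ evalPoly sizePoly n × suc (K * S) ^ d ≤ 2 ^ evalPoly sizePoly n
size-bounds {n} {S} {d} {K} S≤n d≤n 1≤K K≤ = K≤2^p , branching≤2^p
  where
  open ≤-Reasoning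
  x = 2 ^ n
  instance x≢0 = m^n≢0 2 n
  K≤x^ : K ≤ x ^ (2 + n)
  K≤x^ = ≤-trans K≤ (^-monoʳ-≤ x (s≤s (s≤s d≤n)))
  K≤2^p : K ≤ 2 ^ evalPoly sizePoly n
  K≤2^p = begin
    K                             ≤⟨ K≤x^ ⟩
    x ^ (2 + n)                   ≡⟨ ^-*-assoc 2 n (2 + n) ⟩
    2 ^ (n * (2 + n))             ≤⟨ ^-monoʳ-≤ 2 (m≤n+m (n * (2 + n)) (n * ((3 + n) * n))) ⟩
    2 ^ (n * ((3 + n) * n) + n * (2 + n)) ≡⟨ cong (2 ^_) (sym (sizePoly≡ n)) ⟩
    2 ^ evalPoly sizePoly n       ∎
  branching≤2^p : suc (K * S) ^ d ≤ 2 ^ evalPoly sizePoly n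
  branching≤2^p = begin
    suc (K * S) ^ d               ≤⟨ ^-monoˡ-≤ d (begin
      suc (K * S)                   ≤⟨ +-monoˡ-≤ (K * S) 1≤K ⟩
      K + K * S                     ≡⟨ sym (*-suc K S) ⟩
      K * suc S                     ≤⟨ *-mono-≤ K≤x^ (≤-trans (s≤s S≤n) (n<2^n n)) ⟩
      x ^ (2 + n) * x               ≡⟨ *-comm (x ^ (2 + n)) x ⟩
      x ^ (3 + n)                   ∎) ⟩
    (x ^ (3 + n)) ^ d             ≡⟨ ^-*-assoc x (3 + n) d ⟩
    x ^ ((3 + n) * d)             ≤⟨ ^-monoʳ-≤ x (*-monoʳ-≤ (3 + n) d≤n) ⟩
    x ^ ((3 + n) * n)             ≡⟨ ^-*-assoc 2 n ((3 + n) * n) ⟩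
    2 ^ (n * ((3 + n) * n))       ≤⟨ ^-monoʳ-≤ 2 (m≤m+n (n * ((3 + n) * n)) (n * (2 + n))) ⟩
    2 ^ (n * ((3 + n) * n) + n * (2 + n)) ≡⟨ cong (2 ^_) (sym (sizePoly≡ n)) ⟩
    2 ^ evalPoly sizePoly n       ∎

-- Types and faithful representatives

module Subformulas (L : List Fml) where

  S : ℕ
  S = length L

  sub : Fin S → Fml
  sub = List.lookup L

  T : ℕ
  T = 2 ^ S

  -- a type is a set of members of L, coded in Fin (2 ^ S) so that types can be enumerated
  Type : Set
  Type = Fin T

  Vec↔Type : Vec Bool S ↔ Type
  Vec↔Type = Vec↔Fin^ (↔-sym 2↔Bool) S

  bits : Type → Vec Bool S
  bits = Inverse.from Vec↔Type

  _∋_ : Type → Fin S → Set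
  t ∋ i = lookup (bits t) i ≡ true

module Types {ar : ℕ → ℕ} (M : Model ar) (L : List Fml) where
  open Model M
  open Subformulas L public
  open Equivalence
  open IsEquivalence (⇔-isEquivalence {ℓ = 0ℓ}) using () renaming (sym to ⇔-sym; trans to ⇔-trans)

  HasType : W → Type → D → Set
  HasType w t b = ∀ i → t ∋ i ⇔ Sat M w b (sub i)

  SameType : W → D → D → Set
  SameType w b b′ = ∀ i → Sat M w b (sub i) ⇔ Sat M w b′ (sub i)

  typeOf : ∀ w b → ¬ ¬ (∃ λ t → HasType w t b)
  typeOf w b = ¬¬-pull-Fin (λ i → ¬¬-excluded-middle) >>= λ sat? →
    pure (Inverse.to Vec↔Type (tabulate (does ∘ sat?)) , λ i →
      subst (λ v → lookup v i ≡ true ⇔ _) (sym (Inverse.strictlyInverseʳ Vec↔Type _))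
        (subst (λ x → x ≡ true ⇔ _) (sym (lookup∘tabulate (does ∘ sat?) i)) (does⇔ (sat? i))))

  HasType-unique : ∀ {w t t′ b} → HasType w t b → HasType w t′ b → t ≡ t′
  HasType-unique {t = t} {t′} h h′ = from-injective Vec↔Type (begin
    bits t                            ≡⟨ sym (tabulate∘lookup (bits t)) ⟩
    tabulate (lookup (bits t))        ≡⟨ tabulate-cong (λ i → ≡true-unique (h i) (h′ i)) ⟩
    tabulate (lookup (bits t′))       ≡⟨ tabulate∘lookup (bits t′) ⟩
    bits t′                           ∎)
    where open ≡-Reasoning

  HasType⇒SameType : ∀ {w t b b′} → HasType w t b → HasType w t b′ → SameType w b b′
  HasType⇒SameType h h′ i = ⇔-trans (⇔-sym (h i)) (h′ i)

  SameType-sym : ∀ {w b b′} → SameType w b b′ → SameType w b′ b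
  SameType-sym same i = ⇔-sym (same i)

  record Exhaustive {K} (w : W) (g : Fin K → D) (t : Type) : Set where
    field
      covers   : ∀ {b} → HasType w t b → ¬ ¬ (∃ λ e → g e ≡ b)
      distinct : ∀ {e e′} → HasType w t (g e) → g e ≡ g e′ → e ≡ e′

  record Abundant {K} (c : ℕ) (w : W) (g : Fin K → D) (t : Type) : Set where
    field
      count    : ℕ
      c≤count  : c ≤ count
      index    : Fin count → Fin K
      distinct : Injective _≡_ _≡_ (g ∘ index)
      typed    : ∀ l → HasType w t (g (index l))

    slot : Fin c → Fin K
    slot s = index (inject≤ s c≤count)

    slot-distinct : Injective _≡_ _≡_ (g ∘ slot)
    slot-distinct {s} {s′} eq = inject≤-injective _ _ s s′ (distinct eq)

  Faithful : ∀ {K} → ℕ → W → (Fin K → D) → Set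
  Faithful c w g = ∀ t → ¬ ¬ (Exhaustive w g t ⊎ Abundant c w g t)

  Faithful-permute : ∀ {K c w} {g : Fin K → D} (π : Permutation′ K) →
                     Faithful c w g → Faithful c w (g ∘ (π ⟨$⟩ʳ_))
  Faithful-permute {g = g} π faithful t = faithful t >>= λ where
      (inj₁ exh) → pure (inj₁ record
        { covers = λ h → Exhaustive.covers exh h >>= λ (e , eq) →
            pure (π ⟨$⟩ˡ e , trans (cong g (inverseʳ π)) eq)
        ; distinct = λ h eq →
            trans (sym (inverseˡ π)) (trans (cong (π ⟨$⟩ˡ_) (Exhaustive.distinct exh h eq)) (inverseˡ π)) })
      (inj₂ ab) → pure (inj₂ record
        { Abundant ab
        ; index = (π ⟨$⟩ˡ_) ∘ Abundant.index ab
        ; distinct = λ eq →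
            Abundant.distinct ab (trans (sym (cong g (inverseʳ π))) (trans eq (cong g (inverseʳ π))))
        ; typed = λ l → subst (HasType _ t) (sym (cong g (inverseʳ π))) (Abundant.typed ab l) })

  module _ {K c w} {g : Fin K → D} (faithful : Faithful c w g) (i : Fin S) {n} (n≤c : n ≤ c) where
    private
      P : D → Set
      P b = Sat M w b (sub i)

      record Classified (b : D) : Set where
        field
          type     : Type
          has-type : HasType w type b
          class    : Exhaustive w g type ⊎ Abundant c w g type
      open Classified

      classify : ∀ b → ¬ ¬ Classified b
      classify b = typeOf w b >>= λ (t , h) → faithful t >>= λ class →
        pure record { type = t ; has-type = h ; class = class }

      DistinctReps : Set
      DistinctReps = Σ (Fin n → Fin K) λ f → Injective _≡_ _≡_ (g ∘ f) × ∀ l → P (g (f l))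

      reps⇒indices : DistinctReps → AtLeast n (P ∘ g)
      reps⇒indices (f , distinct , sat) = f , (λ eq → distinct (cong g eq)) , sat

      reps⇒elements : DistinctReps → AtLeast n P
      reps⇒elements (f , distinct , sat) = g ∘ f , distinct , sat

      -- all representatives of the type of b satisfy P, and an abundant type has at least n of them
      from-abundant : ∀ {t b} → HasType w t b → P b → Abundant c w g t → DistinctReps
      from-abundant h p ab = slot ∘ f , (λ {x y} eq → inject≤-injective _ _ x y (slot-distinct eq)) ,
                             λ l → Equivalence.to (typed _ i) (Equivalence.from (h i) p)
        where
        open Abundant ab
        f : Fin n → Fin c
        f l = inject≤ l n≤c

    AtLeast-pullback : AtLeast n P → ¬ ¬ AtLeast n (P ∘ g)
    AtLeast-pullback (xs , xs-injective , xs-sat) = ¬¬-pull-Fin (classify ∘ xs) >>= λ classes →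
      case all⊎any (class ∘ classes) of λ where
        (inj₂ (l , ab)) → pure (reps⇒indices (from-abundant (has-type (classes l)) (xs-sat l) ab))
        (inj₁ exh) → ¬¬-pull-Fin (λ l → Exhaustive.covers (exh l) (has-type (classes l))) >>= λ preimage →
                     pure (proj₁ ∘ preimage ,
                           (λ {l l′} eq → xs-injective
                              (trans (sym (proj₂ (preimage l))) (trans (cong g eq) (proj₂ (preimage l′))))) ,
                           λ l → subst P (sym (proj₂ (preimage l))) (xs-sat l))

    AtLeast-image : AtLeast n (P ∘ g) → ¬ ¬ AtLeast n P
    AtLeast-image (f , f-injective , f-sat) = ¬¬-pull-Fin (classify ∘ g ∘ f) >>= λ classes →
      pure (case all⊎any (class ∘ classes) of λ where
        (inj₂ (l , ab)) → reps⇒elements (from-abundant (has-type (classes l)) (f-sat l) ab)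
        (inj₁ exh) → g ∘ f , (λ {l} eq → f-injective (Exhaustive.distinct (exh l) (has-type (classes l)) eq)) ,
                     f-sat)

  module _ {c : ℕ} (w : W) (samples : ∀ t → Sample (HasType w t) c) where
    open Sample

    size′ : Type → ℕ
    size′ t = size (samples t)

    layout : Σ Type (Fin ∘ size′) ↔ Fin (∑ T size′)
    layout = Σ-Fin↔∑ T size′

    gather : Fin (∑ T size′) → D
    gather e = elem (samples (proj₁ (Inverse.from layout e))) (proj₂ (Inverse.from layout e))

    gather-layout : ∀ t k → gather (Inverse.to layout (t , k)) ≡ elem (samples t) k
    gather-layout t k = cong (λ (t , k) → elem (samples t) k) (Inverse.strictlyInverseʳ layout (t , k))

    gather-typed : ∀ e → HasType w (proj₁ (Inverse.from layout e)) (gather e)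
    gather-typed e = elem-sat (samples _) _

    gather-faithful : Faithful c w gather
    gather-faithful t with size′ t <? c
    ... | yes small = pure (inj₁ record
      { covers = λ h → complete (samples t) small h >>= λ (k , eq) →
          pure (Inverse.to layout (t , k) , trans (gather-layout t k) eq)
      ; distinct = λ {e e′} h eq → from-injective layout (same-slot (HasType-unique (gather-typed e) h)
          (HasType-unique (gather-typed e′) (subst (HasType w t) eq h)) eq) })
      where
      same-slot : ∀ {p q : Σ Type (Fin ∘ size′)} → proj₁ p ≡ t → proj₁ q ≡ t →
                  elem (samples (proj₁ p)) (proj₂ p) ≡ elem (samples (proj₁ q)) (proj₂ q) → p ≡ q
      same-slot {.t , k} {.t , k′} refl refl eq = cong (t ,_) (elem-injective (samples t) eq)
    ... | no ¬small = pure (inj₂ record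
      { count = size′ t
      ; c≤count = ≮⇒≥ ¬small
      ; index = λ k → Inverse.to layout (t , k)
      ; distinct = λ {k k′} eq → elem-injective (samples t)
          (trans (sym (gather-layout t k)) (trans eq (gather-layout t k′)))
      ; typed = λ k → subst (HasType w t) (sym (gather-layout t k)) (elem-sat (samples t) k) })

  representatives : ∀ {c} w b → 0 < c →
         ¬ ¬ (Σ ℕ λ K → K ≤ T * c × Σ (Fin K → D) λ g → Faithful c w g × ∃ λ e → SameType w b (g e))
  representatives {c} w b 0<c =
    ¬¬-pull-Fin (λ t → sample (HasType w t) c) >>= λ samples →
    typeOf w b >>= λ (t , h) →
    Sample-nonempty (samples t) 0<c h >>= λ k →
    pure (∑ T (size′ w samples) , ∑-≤ T (λ t → Sample.size≤ (samples t)) ,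
          gather w samples , gather-faithful w samples , Inverse.to (layout w samples) (t , k) ,
          HasType⇒SameType h
            (subst (HasType w t) (sym (gather-layout w samples t k)) (Sample.elem-sat (samples t) k)))

  -- From w to a successor w′, with the threshold going from T·c′ to c′: an exactly represented
  -- w-type keeps its representatives. An abundant w-type has T·c′ slots in columns indexed by
  -- w′-types; column t′ holds a sample of the elements of w-type t and w′-type t′. By pigeonhole
  -- some column is full, and its first element fills all remaining representatives of type t.
  module Reassignment {K c′ : ℕ} (0<c′ : 0 < c′) (w w′ : W) (g : Fin K → D)
    (pairs : ∀ t t′ → Sample (λ b → HasType w t b × HasType w′ t′ b) c′) where
    open Sample

    FullPair : Type → Set
    FullPair t = ∃ λ t* → c′ ≤ size (pairs t t*)

    Class : Type → Set
    Class t = Exhaustive w g t ⊎ (Abundant (T * c′) w g t × FullPair t)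

    open Abundant using (slot; slot-distinct)

    -- the slots of an abundant class of w-type t are indexed by Fin (T * c′) ≅ Type × Fin c′,
    -- and slot (t′ , j) receives the j-th sampled element of w-type t and w′-type t′, if there is one
    position : ∀ {t} → Abundant (T * c′) w g t → ∀ t′ → Fin (size (pairs t t′)) → Fin K
    position ab t′ k = slot ab (combine t′ (inject≤ k (size≤ (pairs _ t′))))

    column : Type → D → Type → Fin c′ → D
    column t dflt t′ = extend (λ k → inject≤ k (size≤ (pairs t t′))) (elem (pairs t t′)) dflt

    slotValue : Type → D → Fin (T * c′) → D
    slotValue t dflt s = uncurry (column t dflt) (remQuot {T} c′ s)

    slotValue-view : ∀ t dflt s → slotValue t dflt s ≡ dflt ⊎ ∃ λ t′ → Σ (Fin (size (pairs t t′))) λ k →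
                     combine t′ (inject≤ k (size≤ (pairs t t′))) ≡ s × slotValue t dflt s ≡ elem (pairs t t′) k
    slotValue-view t dflt s = view (remQuot {T} c′ s) (combine-remQuot {T} c′ s)
      where
      view : ∀ p → uncurry combine p ≡ s → uncurry (column t dflt) p ≡ dflt ⊎ ∃ λ t′ → Σ (Fin (size (pairs t t′))) λ k →
             combine t′ (inject≤ k (size≤ (pairs t t′))) ≡ s × uncurry (column t dflt) p ≡ elem (pairs t t′) k
      view (t′ , j) combine≡s with extend-view (λ k → inject≤ k (size≤ (pairs t t′))) (elem (pairs t t′)) dflt j
      ... | inj₁ eq = inj₁ eq
      ... | inj₂ (k , refl , eq) = inj₂ (t′ , k , combine≡s , eq)

    abundantValue : ∀ {t} → Abundant (T * c′) w g t → D → Fin K → D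
    abundantValue {t} ab dflt = extend (slot ab) (slotValue t dflt) dflt

    abundantValue-position : ∀ {t} ab dflt t′ k →
                             abundantValue {t} ab dflt (position ab t′ k) ≡ elem (pairs t t′) k
    abundantValue-position {t} ab dflt t′ k = begin
      abundantValue ab dflt (position ab t′ k)
        ≡⟨ extend-hit (slot ab) (slotValue t dflt) dflt (λ eq → slot-distinct ab (cong g eq)) _ ⟩
      slotValue t dflt (combine t′ k′)
        ≡⟨ cong (uncurry (column t dflt)) (remQuot-combine t′ k′) ⟩
      column t dflt t′ k′
        ≡⟨ extend-hit _ (elem (pairs t t′)) dflt (inject≤-injective _ _ _ _) k ⟩
      elem (pairs t t′) k
        ∎
      where
      open ≡-Reasoning
      k′ = inject≤ k (size≤ (pairs t t′))

    abundantValue-view : ∀ {t} ab dflt e → abundantValue {t} ab dflt e ≡ dflt ⊎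
      ∃ λ t′ → Σ (Fin (size (pairs t t′))) λ k → position ab t′ k ≡ e × abundantValue ab dflt e ≡ elem (pairs t t′) k
    abundantValue-view {t} ab dflt e with extend-view (slot ab) (slotValue t dflt) dflt e
    ... | inj₁ eq = inj₁ eq
    ... | inj₂ (s , slot≡e , eq) with slotValue-view t dflt s
    ...   | inj₁ eq′ = inj₁ (trans eq eq′)
    ...   | inj₂ (t′ , k , combine≡s , eq′) =
      inj₂ (t′ , k , trans (cong (slot ab) combine≡s) slot≡e , trans eq eq′)

    default : ∀ t → FullPair t → D
    default t (t* , full) = elem (pairs t t*) (fromℕ< (≤-trans 0<c′ full))

    reassign : ∀ t → Class t → Fin K → D
    reassign t (inj₁ _) = g
    reassign t (inj₂ (ab , full)) = abundantValue ab (default t full)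

    reassign-typed : ∀ t cl {e} → HasType w t (g e) → HasType w t (reassign t cl e)
    reassign-typed t (inj₁ _) h = h
    reassign-typed t (inj₂ (ab , t* , full)) {e} h with abundantValue-view ab (default t (t* , full)) e
    ... | inj₁ eq = subst (HasType w t) (sym eq) (proj₁ (elem-sat (pairs t t*) _))
    ... | inj₂ (t′ , k , _ , eq) = subst (HasType w t) (sym eq) (proj₁ (elem-sat (pairs t t′) k))

    module Reassigned (σ : Fin K → Type) (σ-typed : ∀ e → HasType w (σ e) (g e))
                      (classes : ∀ t → Class t) where

      σ-unique : ∀ {t e} → HasType w t (g e) → σ e ≡ t
      σ-unique = HasType-unique (σ-typed _)

      slot-σ : ∀ {t} (ab : Abundant (T * c′) w g t) s → σ (slot ab s) ≡ t
      slot-σ ab s = σ-unique (Abundant.typed ab _)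

      g′ : Fin K → D
      g′ e = reassign (σ e) (classes (σ e)) e

      g′-typed : ∀ e → HasType w (σ e) (g′ e)
      g′-typed e = reassign-typed (σ e) (classes (σ e)) (σ-typed e)

      Agrees : ∀ t → Class t → Set
      Agrees t cl = ∀ {e} → σ e ≡ t → g′ e ≡ reassign t cl e

      g′-agrees : ∀ t → Agrees t (classes t)
      g′-agrees t refl = refl

      FullAt : ∀ t → Class t → Type → Set
      FullAt t (inj₁ _) ρ = ⊥
      FullAt t (inj₂ _) ρ = c′ ≤ size (pairs t ρ)

      fullAt? : ∀ t cl ρ → Dec (FullAt t cl ρ)
      fullAt? t (inj₁ _) ρ = no id
      fullAt? t (inj₂ _) ρ = c′ ≤? size (pairs t ρ)

      module _ {t} (ab : Abundant (T * c′) w g t) (fp : FullPair t) (agrees : Agrees t (inj₂ (ab , fp)))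
               (ρ : Type) where

        position-value : ∀ k → g′ (position ab ρ k) ≡ elem (pairs t ρ) k
        position-value k = trans (agrees (slot-σ ab _)) (abundantValue-position ab _ ρ k)

        position-typed : ∀ k → HasType w′ ρ (g′ (position ab ρ k))
        position-typed k = subst (HasType w′ ρ) (sym (position-value k)) (proj₂ (elem-sat (pairs t ρ) k))

        -- the default value has the full w′-type t*, so a value of the non-full w′-type ρ comes from column ρ
        position-of : ¬ c′ ≤ size (pairs t ρ) → ∀ {e} → σ e ≡ t → HasType w′ ρ (g′ e) →
                      ∃ λ k → position ab ρ k ≡ e × g′ e ≡ elem (pairs t ρ) k
        position-of notFull {e} σe≡t h′ with abundantValue-view ab (default t fp) e
        ... | inj₁ eq = ⊥-elim (notFull (subst (λ ρ → c′ ≤ size (pairs t ρ)) (HasType-unique typed-t* h″) (proj₂ fp)))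
          where
          typed-t* = proj₂ (elem-sat (pairs t (proj₁ fp)) _)
          h″ = subst (HasType w′ ρ) (trans (agrees σe≡t) eq) h′
        ... | inj₂ (t″ , k , pos , eq)
          with HasType-unique (proj₂ (elem-sat (pairs t t″) k)) (subst (HasType w′ ρ) (trans (agrees σe≡t) eq) h′)
        ...   | refl = k , pos , trans (agrees σe≡t) eq

      abundant-at : ∀ t cl ρ → FullAt t cl ρ → Agrees t cl → Abundant c′ w′ g′ ρ
      abundant-at t (inj₂ (ab , fp)) ρ full agrees = record
        { count = size (pairs t ρ)
        ; c≤count = full
        ; index = position ab ρ
        ; distinct = λ {k k′} eq → elem-injective (pairs t ρ)
            (trans (sym (position-value ab fp agrees ρ k)) (trans eq (position-value ab fp agrees ρ k′)))
        ; typed = position-typed ab fp agrees ρ }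

      cover-at : ∀ t cl ρ → ¬ FullAt t cl ρ → Agrees t cl →
                 ∀ {b} → HasType w t b → HasType w′ ρ b → ¬ ¬ (∃ λ e → g′ e ≡ b)
      cover-at t (inj₁ exh) ρ _ agrees h _ = Exhaustive.covers exh h >>= λ (e , eq) →
        pure (e , trans (agrees (σ-unique (subst (HasType w t) (sym eq) h))) eq)
      cover-at t (inj₂ (ab , fp)) ρ notFull agrees h h′ =
        complete (pairs t ρ) (≰⇒> notFull) (h , h′) >>= λ (k , eq) →
        pure (position ab ρ k , trans (position-value ab fp agrees ρ k) eq)

      distinct-at : ∀ t cl ρ → ¬ FullAt t cl ρ → Agrees t cl → ∀ {e e′} → σ e ≡ t → σ e′ ≡ t →
                    HasType w′ ρ (g′ e) → g′ e ≡ g′ e′ → e ≡ e′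
      distinct-at t (inj₁ exh) ρ _ agrees {e} σe σe′ _ eq =
        Exhaustive.distinct exh (subst (λ t → HasType w t (g e)) σe (σ-typed e))
          (trans (sym (agrees σe)) (trans eq (agrees σe′)))
      distinct-at t (inj₂ (ab , fp)) ρ notFull agrees {e} {e′} σe σe′ h′ eq
        with position-of ab fp agrees ρ notFull σe h′
           | position-of ab fp agrees ρ notFull σe′ (subst (HasType w′ ρ) eq h′)
      ... | k , pos , val | k′ , pos′ , val′ = begin
        e                   ≡⟨ sym pos ⟩
        position ab ρ k     ≡⟨ cong (position ab ρ) (elem-injective (pairs t ρ) (trans (sym val) (trans eq val′))) ⟩
        position ab ρ k′    ≡⟨ pos′ ⟩
        e′                  ∎
        where open ≡-Reasoning

      g′-faithful : Faithful c′ w′ g′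
      g′-faithful ρ with any? (λ t → fullAt? t (classes t) ρ)
      ... | yes (t , full) = pure (inj₂ (abundant-at t (classes t) ρ full (g′-agrees t)))
      ... | no none = pure (inj₁ record
        { covers = λ {b} h′ → typeOf w b >>= λ (t , h) → cover-at t (classes t) ρ (none ∘ (t ,_)) (g′-agrees t) h h′
        ; distinct = λ {e e′} h′ eq → distinct-at (σ e) (classes (σ e)) ρ (none ∘ (σ e ,_)) (g′-agrees (σ e)) refl
            (HasType-unique (g′-typed e′) (subst (HasType w (σ e)) eq (g′-typed e))) h′ eq })

      realize-at : ∀ t cl → Agrees t cl → ∀ {ρ e₀} → HasType w t (g e₀) → HasType w′ ρ (g e₀) →
                   ¬ ¬ (∃ λ e₁ → σ e₁ ≡ t × HasType w′ ρ (g′ e₁))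
      realize-at t (inj₁ _) agrees {ρ} {e₀} h h′ =
        pure (e₀ , σ-unique h , subst (HasType w′ ρ) (sym (agrees (σ-unique h))) h′)
      realize-at t (inj₂ (ab , fp)) agrees {ρ} h h′ = Sample-nonempty (pairs t ρ) 0<c′ (h , h′) >>= λ k →
        pure (position ab ρ k , slot-σ ab _ , position-typed ab fp agrees ρ k)

  -- after the reassignment, e₀ is swapped with a representative of its w-type whose new value
  -- has the w′-type of g e₀
  child : ∀ {K c′} → 0 < c′ → ∀ w w′ (g : Fin K → D) → Faithful (T * c′) w g → (e₀ : Fin K) →
          ¬ ¬ (Σ (Fin K → D) λ g″ → Faithful c′ w′ g″ ×
                 (∀ e → SameType w (g e) (g″ e)) × SameType w′ (g e₀) (g″ e₀))
  child {K} {suc m} 0<c′ w w′ g faithful e₀ =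
    ¬¬-pull-Fin (λ e → typeOf w (g e)) >>= λ typing →
    ¬¬-pull-Fin (λ t → ¬¬-pull-Fin λ t′ → sample _ (suc m)) >>= λ pairs →
    ¬¬-pull-Fin (classify pairs) >>= λ classes →
    let open Reassignment 0<c′ w w′ g pairs
        open Reassigned (proj₁ ∘ typing) (proj₂ ∘ typing) classes in
    typeOf w′ (g e₀) >>= λ (ρ , h′) →
    realize-at _ (classes _) (g′-agrees _) (proj₂ (typing e₀)) h′ >>= λ (e₁ , σe₁ , h₁) →
    let π = transpose e₀ e₁ in
    pure (g′ ∘ (π ⟨$⟩ʳ_) , Faithful-permute π g′-faithful ,
          (λ e → HasType⇒SameType (proj₂ (typing e))
                   (subst (λ t → HasType w t (g′ (π ⟨$⟩ʳ e))) (transpose-preserves (proj₁ ∘ typing) (sym σe₁) e)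
                          (g′-typed _))) ,
          HasType⇒SameType h′ (subst (HasType w′ ρ ∘ g′) (sym (transpose-matchˡ e₀ e₁)) h₁))
    where
    classify : (pairs : ∀ t t′ → Sample (λ b → HasType w t b × HasType w′ t′ b) (suc m)) →
               ∀ t → ¬ ¬ Reassignment.Class 0<c′ w w′ g pairs t
    classify pairs t = faithful t >>= λ where
      (inj₁ exh) → pure (inj₁ exh)
      (inj₂ ab) → some-sample-full (pairs t) {{m^n≢0 2 S}} (g ∘ Abundant.slot ab) (Abundant.slot-distinct ab)
                    (λ l → typeOf w′ (g (Abundant.slot ab l)) >>= λ (ρ , h′) → pure (ρ , Abundant.typed ab _ , h′))
                  >>= λ fp → pure (inj₂ (ab , fp))

-- Models given by tables

module Labelled (ar : ℕ → ℕ) (L : List Fml) where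
  open Subformulas L
  open Equivalence

  head₀ : ∀ {k n} → Vec (Fin (suc k)) n → Fin (suc k)
  head₀ [] = zero
  head₀ (x ∷ _) = x

  -- for a nullary P the argument vector is empty, and the type of element 0 decides
  labelled : ∀ {k} (V : Set) → (V → V → Set) → (V → Fin (suc k) → Type) → Model ar
  labelled {k} V E lab = record
    { W = V ; R = E ; D = Fin (suc k) ; pt = zero
    ; I = λ v P xs → ∃ λ i → sub i ≡ atom P × lab v (head₀ xs) ∋ i }

  ≟atom : ∀ φ P → Dec (φ ≡ atom P)
  ≟atom (atom Q) P = map′ (cong atom) (λ { refl → refl }) (Q ℕ.≟ P)
  ≟atom (neg φ) P = no λ ()
  ≟atom (conj φ ψ) P = no λ ()
  ≟atom (dia φ) P = no λ ()
  ≟atom (cnt c φ) P = no λ ()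

  Sat? : ∀ {k m} (E : Fin m → Fin m → Set) → (∀ u v → Dec (E u v)) → (lab : Fin m → Fin (suc k) → Type) →
         ∀ v e ψ → Dec (Sat (labelled (Fin m) E lab) v e ψ)
  Sat? E E? lab v e (atom P) = any? λ i → ≟atom (sub i) P ×-dec (lookup (bits (lab v _)) i Bool.≟ true)
  Sat? E E? lab v e (neg ψ) = ¬? (Sat? E E? lab v e ψ)
  Sat? E E? lab v e (conj ψ χ) = Sat? E E? lab v e ψ ×-dec Sat? E E? lab v e χ
  Sat? E E? lab v e (dia ψ) = any? λ u → E? v u ×-dec Sat? E E? lab u e ψ
  Sat? E E? lab v e (cnt c ψ) = ¬? (atLeast? (suc c) λ e′ → Sat? E E? lab v e′ ψ)

  module _ {k} {V₁ V₂ : Set} {E₁ : V₁ → V₁ → Set} {E₂ : V₂ → V₂ → Set}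
           {lab₁ : V₁ → Fin (suc k) → Type} {lab₂ : V₂ → Fin (suc k) → Type} (ι : V₁ ↔ V₂)
           (E⇔ : ∀ u v → E₁ u v ⇔ E₂ (Inverse.to ι u) (Inverse.to ι v))
           (lab≡ : ∀ v e → lab₁ v e ≡ lab₂ (Inverse.to ι v) e) where

    Sat-transport : ∀ ψ v e → Sat (labelled V₁ E₁ lab₁) v e ψ ⇔ Sat (labelled V₂ E₂ lab₂) (Inverse.to ι v) e ψ
    Sat-transport (atom P) v e = mk⇔
      (λ (i , eq , bit) → i , eq , subst (_∋ i) (lab≡ v _) bit)
      (λ (i , eq , bit) → i , eq , subst (_∋ i) (sym (lab≡ v _)) bit)
    Sat-transport (neg ψ) v e =
      mk⇔ (λ ¬s s → ¬s (from (Sat-transport ψ v e) s)) (λ ¬s s → ¬s (to (Sat-transport ψ v e) s))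
    Sat-transport (conj ψ χ) v e = mk⇔
      (λ (s , s′) → to (Sat-transport ψ v e) s , to (Sat-transport χ v e) s′)
      (λ (s , s′) → from (Sat-transport ψ v e) s , from (Sat-transport χ v e) s′)
    Sat-transport (dia ψ) v e = mk⇔
      (λ (u , edge , s) → Inverse.to ι u , to (E⇔ v u) edge , to (Sat-transport ψ u e) s)
      (λ (u , edge , s) → let u′ = Inverse.from ι u ; back = Inverse.strictlyInverseˡ ι u in
        u′ , from (E⇔ v u′) (subst (E₂ _) (sym back) edge) ,
        from (Sat-transport ψ u′ e) (subst (λ u → Sat _ u e ψ) (sym back) s))
    Sat-transport (cnt c ψ) v e = mk⇔
      (λ ¬many (f , f-injective , sat) → ¬many (f , f-injective , λ l → from (Sat-transport ψ v (f l)) (sat l)))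
      (λ ¬many (f , f-injective , sat) → ¬many (f , f-injective , λ l → to (Sat-transport ψ v (f l)) (sat l)))

module SmallModels (ar : ℕ → ℕ) (φ : Fml) where
  open Subformulas (subs φ)
  open Labelled ar (subs φ)

  -- adjacency matrix of the frame, and the type of each element at each world
  Table : ℕ → ℕ → Set
  Table m k = Vec (Vec Bool m) m × Vec (Vec Type (suc k)) m

  tableModel : ∀ {m k} → Table m k → Model ar
  tableModel {m} (adj , types) =
    labelled (Fin m) (λ u v → lookup (lookup adj u) v ≡ true) (λ v → lookup (lookup types v))

  SmallModel : ℕ → Set
  SmallModel B = ∃ λ m → m < suc B × ∃ λ k → k < B ×
    Σ (Table m k) λ tbl → Σ (Fin m) λ v → Σ (Fin (suc k)) λ e → Sat (tableModel tbl) v e φ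

  smallModel? : ∀ B → Dec (SmallModel B)
  smallModel? B = anyUpTo? (λ m → anyUpTo? (λ k →
    search-× (search-Vec (search-Vec search-Bool m) m) (search-Vec (search-Vec any? (suc k)) m) λ (adj , types) →
      any? λ v → any? λ e → Sat? _ (λ u v → lookup (lookup adj u) v Bool.≟ true) (lookup ∘ lookup types) v e φ)
    B) (suc B)

-- Unravelling

module Unravelling {ar : ℕ → ℕ} (M : Model ar) (φ : Fml) where
  open Model M
  open Types M (subs φ)
  open Labelled ar (subs φ)
  open SmallModels ar φ
  open Equivalence

  n : ℕ
  n = len ar φ

  -- the threshold at height r: above every counting bound of φ, and divisible by T at each level
  cap : ℕ → ℕ
  cap zero = 2 ^ n
  cap (suc r) = T * cap r

  2^n≤cap : ∀ r → 2 ^ n ≤ cap r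
  2^n≤cap zero = ≤-refl
  2^n≤cap (suc r) = ≤-trans (2^n≤cap r) (m≤n*m (cap r) T {{m^n≢0 2 S}})

  cap-positive : ∀ r → 0 < cap r
  cap-positive r = ≤-trans (m^n>0 2 n) (2^n≤cap r)

  SameType⇒Sat : ∀ {w b b′ ψ} → SameType w b b′ → ψ ∈ subs φ → Sat M w b ψ → Sat M w b′ ψ
  SameType⇒Sat {w} {b} {b′} same p s =
    subst (Sat M w b′) (sym (lookup-index p)) (to (same (Any.index p)) (subst (Sat M w b) (lookup-index p) s))

  dia? : ∀ ψ → Dec (∃ λ χ → ψ ≡ dia χ)
  dia? (atom P) = no λ ()
  dia? (neg ψ) = no λ ()
  dia? (conj ψ χ) = no λ ()
  dia? (dia ψ) = yes (ψ , refl)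
  dia? (cnt c ψ) = no λ ()

  module _ (k : ℕ) where
    K : ℕ
    K = suc k

    -- requirement (e , i): element e needs a witness for sub i, if sub i is a diamond in its type
    Req : Set
    Req = Fin K × Fin S

    record Node : Set where
      field
        world : W
        rep   : Fin K → D
        label : Fin K → Type
        typed : ∀ e → HasType world (label e) (rep e)
    open Node

    Active : Node → Req → Set
    Active nd (e , i) = (∃ λ ψ → sub i ≡ dia ψ) × label nd e ∋ i

    active? : ∀ nd y → Dec (Active nd y)
    active? nd (e , i) = dia? (sub i) ×-dec (lookup (bits (label nd e)) i Bool.≟ true)

    Serves : Node → Req → Node → Set
    Serves nd (e , i) nd′ = (∀ e′ → SameType (world nd) (rep nd e′) (rep nd′ e′)) ×
      (∀ {ψ} → sub i ≡ dia ψ → label nd e ∋ i → R (world nd) (world nd′) × Sat M (world nd′) (rep nd′ e) ψ)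

    data Tree : ℕ → Node → Set

    record Branch (r : ℕ) (nd : Node) (y : Req) : Set where
      inductive
      field
        target : Node
        serves : Serves nd y target
        tree   : Tree r target
    open Branch

    data Tree where
      leaf : ∀ {nd} → Faithful (cap 0) (world nd) (rep nd) → Tree 0 nd
      node : ∀ {r nd} → Faithful (cap (suc r)) (world nd) (rep nd) →
             (∀ y → Branch r nd y) → Tree (suc r) nd

    witness : ∀ nd e i → Σ W λ w′ → ∀ {ψ} → sub i ≡ dia ψ → label nd e ∋ i →
              R (world nd) w′ × Sat M w′ (rep nd e) ψ
    witness nd e i with active? nd (e , i)
    ... | no inactive = world nd , λ eq bit → ⊥-elim (inactive ((_ , eq) , bit))
    ... | yes ((ψ , eq) , bit) with subst (Sat M (world nd) (rep nd e)) eq (to (typed nd e i) bit)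
    ...   | w′ , edge , s =
      w′ , λ eq′ _ → edge , subst (Sat M w′ (rep nd e)) (dia-injective (trans (sym eq) eq′)) s
      where
      dia-injective : ∀ {ψ χ} → dia ψ ≡ dia χ → ψ ≡ χ
      dia-injective refl = refl

    child-node : ∀ r nd → Faithful (cap (suc r)) (world nd) (rep nd) → ∀ y →
                 ¬ ¬ (Σ Node λ nd′ → Serves nd y nd′ × Faithful (cap r) (world nd′) (rep nd′))
    child-node r nd faithful (e , i) =
      child (cap-positive r) (world nd) w′ (rep nd) faithful e >>= λ (g″ , faithful″ , same , same′) →
      ¬¬-pull-Fin (λ e′ → typeOf w′ (g″ e′)) >>= λ typing →
      pure (record { world = w′ ; rep = g″ ; label = proj₁ ∘ typing ; typed = proj₂ ∘ typing } ,
            (same , λ {ψ} eq bit → proj₁ (wit eq bit) ,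
                    SameType⇒Sat same′ (dia-∈-subs (subst (_∈ subs φ) eq (∈-lookup i))) (proj₂ (wit eq bit))) ,
            faithful″)
      where
      w′ = proj₁ (witness nd e i)
      wit = proj₂ (witness nd e i)

    grow : ∀ r nd → Faithful (cap r) (world nd) (rep nd) → ¬ ¬ Tree r nd
    grow zero nd faithful = pure (leaf faithful)
    grow (suc r) nd faithful = ¬¬-pull-Fin² (λ y →
        child-node r nd faithful y >>= λ (nd′ , serves , faithful′) →
        grow r nd′ faithful′ >>= λ tree → pure record { target = nd′ ; serves = serves ; tree = tree })
      >>= pure ∘ node faithful

    Addr : ℕ → Set
    Addr zero = ⊤
    Addr (suc r) = ⊤ ⊎ (Req × Addr r)

    root : ∀ r → Addr r
    root zero = tt
    root (suc r) = inj₁ tt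

    IsRoot : ∀ {r} → Addr r → Set
    IsRoot {zero} _ = ⊤
    IsRoot {suc r} (inj₁ _) = ⊤
    IsRoot {suc r} (inj₂ _) = ⊥

    root-IsRoot : ∀ r → IsRoot (root r)
    root-IsRoot zero = tt
    root-IsRoot (suc r) = tt

    isRoot? : ∀ {r} (a : Addr r) → Dec (IsRoot a)
    isRoot? {zero} _ = yes tt
    isRoot? {suc r} (inj₁ _) = yes tt
    isRoot? {suc r} (inj₂ _) = no id

    Subtree : Set
    Subtree = Σ ℕ λ r → Σ Node (Tree r)

    level : Subtree → ℕ
    level = proj₁

    top : Subtree → Node
    top = proj₁ ∘ proj₂

    top-faithful : (s : Subtree) → Faithful (cap (level s)) (world (top s)) (rep (top s))
    top-faithful (_ , _ , leaf faithful) = faithful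
    top-faithful (_ , _ , node faithful _) = faithful

    subtree : ∀ {r nd} → Tree r nd → Addr r → Subtree
    subtree {r} {nd} t@(leaf _) _ = r , nd , t
    subtree {r} {nd} t@(node _ _) (inj₁ _) = r , nd , t
    subtree (node _ ch) (inj₂ (y , a)) = subtree (tree (ch y)) a

    subtree-root : ∀ {r nd} (t : Tree r nd) {a} → IsRoot a → subtree t a ≡ (r , nd , t)
    subtree-root (leaf _) _ = refl
    subtree-root (node _ _) {inj₁ _} _ = refl

    Edge : ∀ {r nd} → Tree r nd → Addr r → Addr r → Set
    Edge (leaf _) _ _ = ⊥
    Edge (node {nd = nd} _ ch) (inj₁ _) (inj₂ (y , a)) = Active nd y × IsRoot a
    Edge (node _ ch) (inj₂ (y , a)) (inj₂ (y′ , a′)) = y ≡ y′ × Edge (tree (ch y)) a a′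
    Edge (node _ _) _ _ = ⊥

    edge? : ∀ {r nd} (t : Tree r nd) a b → Dec (Edge t a b)
    edge? (leaf _) _ _ = no id
    edge? (node {nd = nd} _ ch) (inj₁ _) (inj₂ (y , a)) = active? nd y ×-dec isRoot? a
    edge? (node _ ch) (inj₂ (y , a)) (inj₂ (y′ , a′)) =
      map′ (λ { (refl , e) → refl , e }) (λ { (refl , e) → refl , e })
           (Product.≡-dec _≟_ _≟_ y y′ ×-dec edge? (tree (ch y)) a a′)
    edge? (node _ _) (inj₁ _) (inj₁ _) = no id
    edge? (node _ _) (inj₂ _) (inj₁ _) = no id

    Link : Subtree → Req → Subtree → Set
    Link s y s′ = level s ≡ suc (level s′) × Active (top s) y × Serves (top s) y (top s′)

    edge⇒link : ∀ {r nd} (t : Tree r nd) a b → Edge t a b → ∃ λ y → Link (subtree t a) y (subtree t b)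
    edge⇒link (node {nd = nd} f ch) (inj₁ _) (inj₂ (y , a)) (active , isRoot) =
      y , subst (Link (_ , nd , node f ch) y) (sym (subtree-root (tree (ch y)) isRoot))
                (refl , active , serves (ch y))
    edge⇒link (node f ch) (inj₂ (y , a)) (inj₂ (.y , a′)) (refl , edge) = edge⇒link (tree (ch y)) a a′ edge

    link⇒edge : ∀ {r nd} (t : Tree r nd) a {y} → 0 < level (subtree t a) → Active (top (subtree t a)) y →
                ∃ λ b → Edge t a b × Link (subtree t a) y (subtree t b)
    link⇒edge (node {nd = nd} f ch) (inj₁ _) {y} _ active =
      inj₂ (y , root _) , (active , root-IsRoot _) ,
      subst (Link (_ , nd , node f ch) y) (sym (subtree-root (tree (ch y)) (root-IsRoot _)))
            (refl , active , serves (ch y))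
    link⇒edge (leaf _) _ ()
    link⇒edge (node f ch) (inj₂ (y′ , a)) {y} 0<level active
      with link⇒edge (tree (ch y′)) a {y} 0<level active
    ... | b , edge , link = inj₂ (y′ , b) , (refl , edge) , link

    addresses : ℕ → ℕ
    addresses zero = 1
    addresses (suc r) = 1 + (K * S) * addresses r

    Addr↔Fin : ∀ r → Addr r ↔ Fin (addresses r)
    Addr↔Fin zero = ↔-sym 1↔⊤
    Addr↔Fin (suc r) =
      ↔-trans (↔-sym 1↔⊤ ⊎-↔ ↔-trans (↔-sym *↔× ×-↔ Addr↔Fin r) (↔-sym *↔×)) (↔-sym +↔⊎)

    addresses≤ : ∀ r → addresses r ≤ suc (K * S) ^ r
    addresses≤ zero = ≤-refl
    addresses≤ (suc r) = +-mono-≤ (m^n>0 (suc (K * S)) r) (*-monoʳ-≤ (K * S) (addresses≤ r))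

    replicate-head₀ : ∀ {A : Set} m (f : Fin K → A) e →
                      replicate m (f (head₀ (replicate m e))) ≡ replicate m (f e)
    replicate-head₀ zero f e = refl
    replicate-head₀ (suc m) f e = refl

    module _ {nd₀ : Node} (t₀ : Tree (md φ) nd₀) where

      at : Addr (md φ) → Node
      at a = top (subtree t₀ a)

      height : Addr (md φ) → ℕ
      height a = level (subtree t₀ a)

      unravelled : Model ar
      unravelled = labelled (Addr (md φ)) (Edge t₀) (label ∘ at)

      truth : ∀ {ψ} → ψ ∈ subs φ → ∀ a → md ψ ≤ height a → ∀ e →
              Sat unravelled a e ψ ⇔ Sat M (world (at a)) (rep (at a) e) ψ
      truth {atom P} p a _ e = mk⇔
        (λ (i , eq , bit) → subst (I (world (at a)) P) (replicate-head₀ (ar P) (rep (at a)) e)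
                              (subst (Sat M _ _) eq (to (typed (at a) e* i) bit)))
        (λ s → Any.index p , sym (lookup-index p) , from (typed (at a) e* (Any.index p))
                 (subst (Sat M _ _) (lookup-index p)
                   (subst (I (world (at a)) P) (sym (replicate-head₀ (ar P) (rep (at a)) e)) s)))
        where e* = head₀ (replicate (ar P) e)
      truth {neg ψ} p a bound e = mk⇔ (λ ¬s s → ¬s (from IH s)) (λ ¬s s → ¬s (to IH s))
        where IH = truth (neg-∈-subs p) a bound e
      truth {conj ψ χ} p a bound e = mk⇔
        (λ (s , s′) → to IHˡ s , to IHʳ s′) (λ (s , s′) → from IHˡ s , from IHʳ s′)
        where
        IHˡ = truth (conj-∈-subsˡ p) a (≤-trans (m≤m⊔n (md ψ) (md χ)) bound) e
        IHʳ = truth (conj-∈-subsʳ p) a (≤-trans (m≤n⊔m (md ψ) (md χ)) bound) e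
      truth {dia ψ} p a bound e = mk⇔ forth back
        where
        IH : ∀ b → height a ≡ suc (height b) → Sat unravelled b e ψ ⇔ Sat M (world (at b)) (rep (at b) e) ψ
        IH b height≡ = truth (dia-∈-subs p) b (≤-pred (subst (suc (md ψ) ≤_) height≡ bound)) e
        forth : Sat unravelled a e (dia ψ) → Sat M (world (at a)) (rep (at a) e) (dia ψ)
        forth (b , edge , s) with edge⇒link t₀ a b edge
        ... | _ , height≡ , ((_ , eq) , bit) , same , serve =
          SameType⇒Sat (SameType-sym (same e)) p (world (at b) , proj₁ (serve eq bit) , to (IH b height≡) s)
        back : Sat M (world (at a)) (rep (at a) e) (dia ψ) → Sat unravelled a e (dia ψ)
        bit : Sat M (world (at a)) (rep (at a) e) (dia ψ) → label (at a) e ∋ Any.index p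
        bit s = from (typed (at a) e (Any.index p)) (subst (Sat M _ _) (lookup-index p) s)
        back s with link⇒edge t₀ a {e , Any.index p} (≤-trans (s≤s z≤n) bound) ((ψ , sym (lookup-index p)) , bit s)
        ... | b , edge , height≡ , _ , _ , serve =
          b , edge , from (IH b height≡) (proj₂ (serve (sym (lookup-index p)) (bit s)))
      truth {cnt c ψ} p a bound e = mk⇔ forth back
        where
        q = cnt-∈-subs p
        i = Any.index q
        w = world (at a)
        g = rep (at a)
        IH : ∀ e′ → Sat unravelled a e′ ψ ⇔ Sat M w (g e′) ψ
        IH = truth q a bound
        c<cap : suc c ≤ cap (height a)
        c<cap = ≤-trans (cnt-∈-subs-bound ar p) (2^n≤cap (height a))
        faithful = top-faithful (subtree t₀ a)
        to-sub : ∀ {b} → Sat M w b ψ → Sat M w b (sub i)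
        to-sub = subst (Sat M w _) (lookup-index q)
        from-sub : ∀ {b} → Sat M w b (sub i) → Sat M w b ψ
        from-sub = subst (Sat M w _) (sym (lookup-index q))
        forth : Sat unravelled a e (cnt c ψ) → Sat M w (g e) (cnt c ψ)
        forth ¬many many = AtLeast-pullback faithful i c<cap (AtLeast-map (λ {b} → to-sub {b}) many)
          (λ many′ → ¬many (AtLeast-map (λ {e′} s → from (IH e′) (from-sub s)) many′))
        back : Sat M w (g e) (cnt c ψ) → Sat unravelled a e (cnt c ψ)
        back ¬many many = AtLeast-image faithful i c<cap (AtLeast-map (λ {e′} s → to-sub (to (IH e′) s)) many)
          (λ many′ → ¬many (AtLeast-map (λ {b} → from-sub {b}) many′))

      ι : Addr (md φ) ↔ Fin (addresses (md φ))
      ι = Addr↔Fin (md φ)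

      encode = Inverse.to ι
      decode = Inverse.from ι

      table : Table (addresses (md φ)) k
      table = tabulate (λ u → tabulate λ v → does (edge? t₀ (decode u) (decode v))) ,
              tabulate (λ v → tabulate (label (at (decode v))))

      unravelled⇔table : ∀ a e → Sat unravelled a e φ ⇔ Sat (tableModel table) (encode a) e φ
      unravelled⇔table = Sat-transport {E₂ = λ u v → lookup (lookup (proj₁ table) u) v ≡ true}
                                       {lab₂ = λ v → lookup (lookup (proj₂ table) v)} ι edge⇔ label≡ φ
        where
        open IsEquivalence (⇔-isEquivalence {ℓ = 0ℓ}) using () renaming (sym to ⇔-sym)
        decode-encode = Inverse.strictlyInverseʳ ι
        edge⇔ : ∀ u v → Edge t₀ u v ⇔ (lookup (lookup (proj₁ table) (encode u)) (encode v) ≡ true)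
        edge⇔ u v = subst (λ x → Edge t₀ u v ⇔ (x ≡ true)) (sym (lookup∘tabulate² _ (encode u) (encode v)))
          (subst₂ (λ u′ v′ → Edge t₀ u v ⇔ (does (edge? t₀ u′ v′) ≡ true))
                  (sym (decode-encode u)) (sym (decode-encode v)) (⇔-sym (does⇔ (edge? t₀ u v))))
        label≡ : ∀ v e → label (at v) e ≡ lookup (lookup (proj₂ table) (encode v)) e
        label≡ v e = sym (trans (lookup∘tabulate² (label ∘ at ∘ decode) (encode v) e)
                                (cong (λ v → label (at v) e) (decode-encode v)))

      root-sat : ∀ {e} → Sat M (world nd₀) (rep nd₀ e) φ →
                 Sat (tableModel table) (encode (root (md φ))) e φ
      root-sat {e} s = to (unravelled⇔table (root _) e)
        (from (truth (here refl) (root _) (≤-reflexive (cong level (sym at-root))) e)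
              (subst (λ s → Sat M (world (top s)) (rep (top s) e) φ) (sym at-root) s))
        where at-root = subtree-root t₀ (root-IsRoot (md φ))

  cap≤ : ∀ r → cap r ≤ (2 ^ n) ^ suc r
  cap≤ zero = ≤-reflexive (sym (*-identityʳ (2 ^ n)))
  cap≤ (suc r) = *-mono-≤ (^-monoʳ-≤ 2 (length-subs≤len ar φ)) (cap≤ r)

  smallModel : ∀ {w₀ b₀} → Sat M w₀ b₀ φ → ¬ ¬ SmallModel (2 ^ evalPoly sizePoly n)
  smallModel {w₀} {b₀} s₀ =
    representatives w₀ b₀ (cap-positive (md φ)) >>= λ (K , K≤ , g , faithful , e₀ , same₀) →
    unravel K K≤ g faithful e₀ same₀
    where
    unravel : ∀ K → K ≤ T * cap (md φ) → (g : Fin K → D) → Faithful (cap (md φ)) w₀ g → (e₀ : Fin K) →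
              SameType w₀ b₀ (g e₀) → ¬ ¬ SmallModel (2 ^ evalPoly sizePoly n)
    unravel (suc k) K≤ g faithful e₀ same₀ =
      ¬¬-pull-Fin (typeOf w₀ ∘ g) >>= λ typing →
      grow k (md φ) (record { world = w₀ ; rep = g ; label = proj₁ ∘ typing ; typed = proj₂ ∘ typing }) faithful
      >>= λ t₀ →
      pure (addresses k (md φ) , s≤s (≤-trans (addresses≤ k (md φ)) (proj₂ bounds)) , k , proj₁ bounds ,
            table k t₀ , encode k t₀ (root k (md φ)) , e₀ ,
            root-sat k t₀ (SameType⇒Sat same₀ (here refl) s₀))
      where
      bounds = size-bounds (length-subs≤len ar φ) (md≤len ar φ) (s≤s z≤n)
                 (≤-trans K≤ (*-mono-≤ (^-monoʳ-≤ 2 (length-subs≤len ar φ)) (cap≤ (md φ))))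

theorem2 : (ar : ℕ → ℕ) →
    Σ (List ℕ) λ p → (φ : Fml) → Satisfiable ar φ →
    Σ (Model ar) λ M → Σ ℕ λ m → Σ ℕ λ k →
    (Model.W M ↔ Fin m) × (Model.D M ↔ Fin k) ×
    m ≤ 2 ^ evalPoly p (len ar φ) × k ≤ 2 ^ evalPoly p (len ar φ) ×
    Σ (Model.W M) λ w → Σ (Model.D M) λ b → Sat M w b φ
theorem2 ar = sizePoly , λ φ (M , w₀ , b₀ , s₀) →
  let open SmallModels ar φ in
  case decidable-stable (smallModel? _) (Unravelling.smallModel M φ s₀) of λ
    (m , m<1+B , k , k<B , tbl , v , e , s) →
      tableModel tbl , m , suc k , ↔-id _ , ↔-id _ , ≤-pred m<1+B , k<B , v , e , s
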